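{- For word length $n=2$, counting ones in the input $x$ (i.e., outputting $\nu(x)$) can be done in the computational model described in the context by a program that performs exactly one decrement operation if $x$ is not zero and no increment or decrement operation if $x=00$. This bound cannot be improved: no program in this model that correctly outputs $\nu(x)$ for all inputs of length two avoids performing an increment or decrement operation on all nonzero inputs.
   Context: $\nu(x)$ denotes the number of ones in the binary word $x$. Computational model: a program operates on unsigned integer variables, each holding an $n$-bit word. The input word $x$ is stored in a variable $x$; all other variables are initially zero. The available operations are increment and decrement (modulo $2^n$, so incrementing the all-ones word gives zero and decrementing zero gives the all-ones word), bitwise logical AND and OR, and assignment. The only constant available in assignments and comparisons is zero. Control flow may depend on comparisons between variables or with zero, and the program outputs the value of a variable. -}

module Defs where

open import Data.Bool using (Bool; true; false; _∧_; _∨_; not)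
open import Data.Nat using (ℕ; zero; suc; _+_; _<ᵇ_)
open import Data.Fin using (Fin)
open import Data.Vec using (Vec; []; _∷_; zipWith; replicate; count)
open import Data.List using (List; lookup; length)
open import Data.Maybe using (Maybe; just; nothing)
open import Data.Product using (_×_; _,_)
open import Relation.Nullary using (does)
open import Relation.Nullary.Decidable using (⌊_⌋)
open import Data.Vec.Properties using (≡-dec)
open import Data.Bool.Properties using () renaming (_≟_ to _≟B_)
import Data.Nat as N

-- An n-bit word, least significant bit first.
Word : ℕ → Set
Word n = Vec Bool n

0w : ∀ {n} → Word n
0w = replicate _ false

ν : ∀ {n} → Word n → ℕ
ν x = count (λ b → b ≟B true) x

val : ∀ {n} → Word n → ℕ
val [] = 0
val (b ∷ w) = (if b then 1 else 0) + 2 * val w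
  where open import Data.Bool using (if_then_else_)
        open import Data.Nat using (_*_)

-- the n-bit binary word encoding m mod 2^n (LSB first)
toWord : (n : ℕ) → ℕ → Word n
toWord zero m = []
toWord (suc n) m = (m N.% 2 N.≡ᵇ 1) ∷ toWord n (m N./ 2)

-- increment / decrement modulo 2^n (ripple carry / borrow)
incW : ∀ {n} → Word n → Word n
incW [] = []
incW (false ∷ w) = true ∷ w
incW (true ∷ w) = false ∷ incW w

decW : ∀ {n} → Word n → Word n
decW [] = []
decW (true ∷ w) = false ∷ w
decW (false ∷ w) = true ∷ decW w

andW orW : ∀ {n} → Word n → Word n → Word n
andW = zipWith _∧_
orW = zipWith _∨_

-- Programs over variables Fin (suc k); variable 0 holds the input x,
-- all other variables start at zero.  Labels are positions in the
-- instruction list.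
data Operand (k : ℕ) : Set where
  var  : Fin (suc k) → Operand k
  zero : Operand k

data Instr (k : ℕ) : Set where
  assign : Fin (suc k) → Operand k → Instr k
  and    : Fin (suc k) → Fin (suc k) → Fin (suc k) → Instr k
  or     : Fin (suc k) → Fin (suc k) → Fin (suc k) → Instr k
  inc    : Fin (suc k) → Fin (suc k) → Instr k
  dec    : Fin (suc k) → Fin (suc k) → Instr k
  ifEq   : Operand k → Operand k → ℕ → Instr k
  ifLt   : Operand k → Operand k → ℕ → Instr k
  output : Fin (suc k) → Instr k

Program : ℕ → Set
Program k = List (Instr k)

Env : ℕ → ℕ → Set
Env n k = Fin (suc k) → Word n

initEnv : ∀ {n k} → Word n → Env n k
initEnv x Fin.zero = x
initEnv x (Fin.suc _) = 0w

update : ∀ {n k} → Env n k → Fin (suc k) → Word n → Env n k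
update ρ v w u with does (v Data.Fin.≟ u)
... | true = w
... | false = ρ u

evalOp : ∀ {n k} → Env n k → Operand k → Word n
evalOp ρ (var v) = ρ v
evalOp ρ zero = 0w

record Result (n : ℕ) : Set where
  constructor result
  field
    out  : Word n
    incs : ℕ
    decs : ℕ

-- Fuel-bounded execution from program counter pc with counters i, d.
-- Falling off the program (bad label) is a run without output.
exec : ∀ {n k} → ℕ → Program k → ℕ → Env n k → ℕ → ℕ → Maybe (Result n)
exec zero P pc ρ i d = nothing
exec {n} (suc f) P pc ρ i d with pc N.<? length P
... | Relation.Nullary.no _ = nothing
... | Relation.Nullary.yes lt with lookup P (Data.Fin.fromℕ< lt)
...   | assign v a = exec f P (suc pc) (update ρ v (evalOp ρ a)) i d
...   | and v w u  = exec f P (suc pc) (update ρ v (andW (ρ w) (ρ u))) i d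
...   | or v w u   = exec f P (suc pc) (update ρ v (orW (ρ w) (ρ u))) i d
...   | inc v w    = exec f P (suc pc) (update ρ v (incW (ρ w))) (suc i) d
...   | dec v w    = exec f P (suc pc) (update ρ v (decW (ρ w))) i (suc d)
...   | ifEq a b l = exec f P (if ⌊ ≡-dec _≟B_ (evalOp ρ a) (evalOp ρ b) ⌋ then l else suc pc) ρ i d
  where open import Data.Bool using (if_then_else_)
...   | ifLt a b l = exec f P (if val (evalOp ρ a) <ᵇ val (evalOp ρ b) then l else suc pc) ρ i d
  where open import Data.Bool using (if_then_else_)
...   | output v   = just (result (ρ v) i d)

Runs : ∀ {n k} → Program k → Word n → Result n → Set
Runs P x r = Data.Product.∃ λ fuel → exec fuel P 0 (initEnv x) 0 0 Relation.Binary.PropositionalEquality.≡ just r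
  where import Relation.Binary.PropositionalEquality

-- Upper bound: jump to the output of x itself when x = 00; otherwise x - 1 is
-- 00 exactly when x = 01, in which case x is the answer, and is otherwise the
-- answer 01 (for x = 10 and x = 11).
-- Lower bound: AND, OR, assignment and the constant zero all map constant words
-- (00 and 11) to constant words, and without increments or decrements nothing
-- else changes a variable.  On input 11 every variable is therefore constant
-- throughout, so the answer ν(11) = 2, encoded as 01, can never be output.
module Submission where

open import Defs
open import Data.Nat using (ℕ; _+_)
open import Data.Product using (Σ; ∃; _×_)
open import Relation.Binary.PropositionalEquality using (_≡_; _≢_)
open import Relation.Nullary using (¬_)

open import Data.Bool using (true; false; _∧_; _∨_)
open import Data.Nat using (zero; suc; _≤_)
open import Data.Nat.Properties using (≤-refl; ≤-trans; n≤1+n; n≮n; m+n≡0⇒m≡0; m+n≡0⇒n≡0)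
import Data.Fin as F
open import Data.Vec using ([]; _∷_; replicate)
open import Data.Vec.Properties using (zipWith-replicate)
open import Data.List using ([]; _∷_; lookup; length)
open import Data.Maybe using (just)
open import Data.Product using (_,_; proj₁; proj₂)
open import Relation.Binary.PropositionalEquality using (refl; subst)
open import Relation.Nullary using (does; yes)
open import Data.Empty using (⊥-elim)
import Data.Nat as N

countOnes₂ : Program 1
countOnes₂ =
  ifEq (var F.zero) zero 4 ∷
  dec (F.suc F.zero) F.zero ∷
  ifEq (var (F.suc F.zero)) zero 4 ∷
  output (F.suc F.zero) ∷
  output F.zero ∷ []

countOnes₂-correct : (x : Word 2) → Σ (Result 2) λ r →
  Runs countOnes₂ x r × Result.out r ≡ toWord 2 (ν x)
  × (x ≡ 0w → Result.incs r ≡ 0 × Result.decs r ≡ 0)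
  × (x ≢ 0w → Result.incs r ≡ 0 × Result.decs r ≡ 1)
countOnes₂-correct (false ∷ false ∷ []) = _ , (5 , refl) , refl , (λ _ → refl , refl) , λ x≢0 → ⊥-elim (x≢0 refl)
countOnes₂-correct (true  ∷ false ∷ []) = _ , (5 , refl) , refl , (λ ()) , λ _ → refl , refl
countOnes₂-correct (false ∷ true  ∷ []) = _ , (5 , refl) , refl , (λ ()) , λ _ → refl , refl
countOnes₂-correct (true  ∷ true  ∷ []) = _ , (5 , refl) , refl , (λ ()) , λ _ → refl , refl

exec-counters-grow : ∀ {n k} f (P : Program k) pc (ρ : Env n k) i d r →
  exec f P pc ρ i d ≡ just r → i ≤ Result.incs r × d ≤ Result.decs r
exec-counters-grow (suc f) P pc ρ i d r e with pc N.<? length P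
... | yes lt with lookup P (F.fromℕ< lt)
...   | assign v a = exec-counters-grow f P _ _ i d r e
...   | and v w u  = exec-counters-grow f P _ _ i d r e
...   | or v w u   = exec-counters-grow f P _ _ i d r e
...   | ifEq a b l = exec-counters-grow f P _ _ i d r e
...   | ifLt a b l = exec-counters-grow f P _ _ i d r e
...   | inc v w    = let i< , d≤ = exec-counters-grow f P _ _ (suc i) d r e in ≤-trans (n≤1+n i) i< , d≤
...   | dec v w    = let i≤ , d< = exec-counters-grow f P _ _ i (suc d) r e in i≤ , ≤-trans (n≤1+n d) d<
...   | output v with refl ← e = ≤-refl , ≤-refl

record LogicClosed {n} (S : Word n → Set) : Set where
  field
    zero-closed : S 0w
    and-closed  : ∀ {w u} → S w → S u → S (andW w u)
    or-closed   : ∀ {w u} → S w → S u → S (orW w u)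

module _ {n} {S : Word n → Set} (closed : LogicClosed S) where
  open LogicClosed closed

  update-closed : ∀ {k} {ρ : Env n k} v {w} → (∀ u → S (ρ u)) → S w → ∀ u → S (update ρ v w u)
  update-closed v Sρ Sw u with does (v F.≟ u)
  ... | true  = Sw
  ... | false = Sρ u

  evalOp-closed : ∀ {k} {ρ : Env n k} a → (∀ u → S (ρ u)) → S (evalOp ρ a)
  evalOp-closed (var v) Sρ = Sρ v
  evalOp-closed zero    Sρ = zero-closed

  -- The starting counters are carried along only so that an increment or
  -- decrement, which would raise them, can be ruled out by exec-counters-grow.
  exec-without-incDec-output-closed : ∀ {k} f (P : Program k) pc (ρ : Env n k) i d r →
    exec f P pc ρ i d ≡ just r → (∀ u → S (ρ u)) →
    Result.incs r ≡ i → Result.decs r ≡ d → S (Result.out r)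
  exec-without-incDec-output-closed (suc f) P pc ρ i d r e Sρ incs≡i decs≡d with pc N.<? length P
  ... | yes lt with lookup P (F.fromℕ< lt)
  ...   | assign v a = exec-without-incDec-output-closed f P _ _ i d r e
                         (update-closed v Sρ (evalOp-closed a Sρ)) incs≡i decs≡d
  ...   | and v w u  = exec-without-incDec-output-closed f P _ _ i d r e
                         (update-closed v Sρ (and-closed (Sρ w) (Sρ u))) incs≡i decs≡d
  ...   | or v w u   = exec-without-incDec-output-closed f P _ _ i d r e
                         (update-closed v Sρ (or-closed (Sρ w) (Sρ u))) incs≡i decs≡d
  ...   | ifEq a b l = exec-without-incDec-output-closed f P _ _ i d r e Sρ incs≡i decs≡d
  ...   | ifLt a b l = exec-without-incDec-output-closed f P _ _ i d r e Sρ incs≡i decs≡d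
  ...   | inc v w    = ⊥-elim (n≮n i (subst (suc i ≤_) incs≡i
                         (proj₁ (exec-counters-grow f P _ _ (suc i) d r e))))
  ...   | dec v w    = ⊥-elim (n≮n d (subst (suc d ≤_) decs≡d
                         (proj₂ (exec-counters-grow f P _ _ i (suc d) r e))))
  ...   | output v with refl ← e = Sρ v

Constant : ∀ {n} → Word n → Set
Constant {n} w = ∃ λ b → w ≡ replicate n b

constant-logicClosed : ∀ {n} → LogicClosed (Constant {n})
constant-logicClosed = record
  { zero-closed = false , refl
  ; and-closed  = λ { (b , refl) (c , refl) → b ∧ c , zipWith-replicate _∧_ b c }
  ; or-closed   = λ { (b , refl) (c , refl) → b ∨ c , zipWith-replicate _∨_ b c }
  }

initEnv-constant : ∀ {n k} b → ∀ v → Constant (initEnv {n} {k} (replicate n b) v)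
initEnv-constant b F.zero    = b , refl
initEnv-constant b (F.suc _) = false , refl

two-not-constant : ¬ Constant (toWord 2 2)
two-not-constant (false , ())
two-not-constant (true  , ())

no-incDec-free-countOnes₂ : ¬ (∃ λ (k : ℕ) → Σ (Program k) λ P → (x : Word 2) → Σ (Result 2) λ r →
  Runs P x r × Result.out r ≡ toWord 2 (ν x)
  × (x ≢ 0w → Result.incs r + Result.decs r ≡ 0))
no-incDec-free-countOnes₂ (k , P , counts) with counts (true ∷ true ∷ [])
... | r , (f , runs) , out≡ , noIncDec =
  two-not-constant (subst Constant out≡
    (exec-without-incDec-output-closed constant-logicClosed f P 0 _ 0 0 r runs
      (initEnv-constant true) (m+n≡0⇒m≡0 _ sum≡0) (m+n≡0⇒n≡0 _ sum≡0)))
  where sum≡0 = noIncDec λ ()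

mainTheorem3 : (∃ λ (k : ℕ) → Σ (Program k) λ P → (x : Word 2) → Σ (Result 2) λ r →
    Runs P x r × Result.out r ≡ toWord 2 (ν x)
    × (x ≡ 0w → Result.incs r ≡ 0 × Result.decs r ≡ 0)
    × (x ≢ 0w → Result.incs r ≡ 0 × Result.decs r ≡ 1))
    × ¬ (∃ λ (k : ℕ) → Σ (Program k) λ P → (x : Word 2) → Σ (Result 2) λ r →
    Runs P x r × Result.out r ≡ toWord 2 (ν x)
    × (x ≢ 0w → Result.incs r + Result.decs r ≡ 0))
mainTheorem3 = (1 , countOnes₂ , countOnes₂-correct) , no-incDec-free-countOnes₂
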